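{- For every nonnegative integer $n$ and all real numbers $a,\ell$, $$\sum_{i+j=n}\binom{2i+a}{i}\binom{2j}{j}=\sum_{i+j=n}\binom{2i+a-\ell}{i}\binom{2j+\ell}{j},$$ where both sums range over nonnegative integers $i,j$ with $i+j=n$.
   Context: For a real number $x$ and a nonnegative integer $i$, $\binom{x}{i}=\frac{x(x-1)\cdots(x-i+1)}{i!}$ (generalized binomial coefficient; $\binom{x}{0}=1$). -}

module Defs where

open import Level using (Level; _⊔_)
open import Data.Nat using (ℕ; zero; suc; _∸_) renaming (_*_ to _*ℕ_)
open import Algebra.Bundles using (CommutativeRing)

module RingOps {c ℓ : Level} (R : CommutativeRing c ℓ) where
  open CommutativeRing R

  ι : ℕ → Carrier
  ι zero    = 0#
  ι (suc n) = 1# + ι n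

-- A commutative ring in which every positive integer n·1 is invertible
-- (i.e. a Q-algebra).  The real numbers are such a ring.
record QAlgebra (c ℓ : Level) : Set (Level.suc (c ⊔ ℓ)) where
  field
    cring    : CommutativeRing c ℓ
    inv      : ℕ → CommutativeRing.Carrier cring          -- inv n = 1/(n+1)
    inv-spec : ∀ n → CommutativeRing._≈_ cring
                       (CommutativeRing._*_ cring (RingOps.ι cring (suc n)) (inv n))
                       (CommutativeRing.1# cring)
  open CommutativeRing cring public
  open RingOps cring public

  falling : Carrier → ℕ → Carrier
  falling x zero    = 1#
  falling x (suc i) = falling x i * (x + - ι i)

  invFact : ℕ → Carrier
  invFact zero    = 1#
  invFact (suc i) = invFact i * inv i

  binom : Carrier → ℕ → Carrier
  binom x i = falling x i * invFact i

  sumBelow : ℕ → (ℕ → Carrier) → Carrier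
  sumBelow zero    f = 0#
  sumBelow (suc m) f = sumBelow m f + f m

  sumAntidiag : ℕ → (ℕ → ℕ → Carrier) → Carrier
  sumAntidiag n f = sumBelow (suc n) (λ i → f i (n ∸ i))

  two* : ℕ → Carrier
  two* i = ι (2 *ℕ i)

module Submission where

-- Write C x i = binom (2i + x) i and (f ⋆ g) n = Σ_{i+j=n} f i * g j for the
-- convolution of sequences.  The theorem says that (C a ⋆ C b) n depends only
-- on a + b (take b = 0 on the left, (a - l, l) on the right).
--
-- Generating functions are not available, so the argument is an induction on
-- n driven by two recurrences:
--   * Leibniz rule for ⋆ :  (n+1) (f ⋆ g)(n+1) = (f' ⋆ g) n + (g' ⋆ f) n,
--     where f' i = (i+1) f (i+1) is the formal derivative;
--   * the derivative of C x is a linear combination of C (x+1), the shifted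
--     sequence t·C (x+2), the Euler weight i·C x i and C x itself, with
--     coefficients depending only on x (this comes from Pascal's rule and the
--     absorption/ratio identities for generalized binomials).
-- Together they express (n+1) (C a ⋆ C b)(n+1) through convolutions at n and
-- n-1 whose shifts are (a+1, b), (b+1, a), ... with coefficients a, b; when
-- those depend only on a + b so does the whole right-hand side, and dividing
-- by n+1 (possible in a Q-algebra) closes the induction.

open import Level using (Level; _⊔_)
open import Data.Nat as ℕ using (ℕ; zero; suc; _∸_)
open import Data.Integer as ℤ using (ℤ; +_; -[1+_]; _⊖_; _◃_)
import Data.Integer.Properties as ℤP
import Data.Nat.Properties as ℕP
import Data.Sign as Sign
open import Data.Maybe using (Maybe; just; nothing)
open import Data.Product using (_×_; _,_; proj₁)
open import Relation.Nullary using (yes; no)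
import Relation.Binary.PropositionalEquality as P
open import Algebra.Bundles using (CommutativeRing)
import Algebra.Properties.Ring as RingProperties
import Algebra.Solver.Ring.AlmostCommutativeRing as ACR
import Algebra.Solver.Ring as RingSolver
import Relation.Binary.Reasoning.Setoid as SetoidReasoning
open import Defs

-- The canonical map ℤ → R is a ring homomorphism; this instantiates the
-- stdlib ring solver with integer coefficients for an arbitrary commutative
-- ring R.  The constant `con (+ k)` is interpreted as `num k`.
module IntegerSolver {c ℓ : Level} (R : CommutativeRing c ℓ) where
  open CommutativeRing R
  open RingOps R
  open RingProperties ring using (-‿involutive; -‿distribˡ-*; -‿distribʳ-*; -0#≈0#; -‿+-comm)
  open SetoidReasoning setoid

  ι-+ : ∀ m n → ι (m ℕ.+ n) ≈ ι m + ι n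
  ι-+ zero    n = sym (+-identityˡ _)
  ι-+ (suc m) n = trans (+-congˡ (ι-+ m n)) (sym (+-assoc _ _ _))

  ι-* : ∀ m n → ι (m ℕ.* n) ≈ ι m * ι n
  ι-* zero    n = sym (zeroˡ _)
  ι-* (suc m) n = begin
    ι (n ℕ.+ m ℕ.* n)     ≈⟨ ι-+ n (m ℕ.* n) ⟩
    ι n + ι (m ℕ.* n)     ≈⟨ +-cong (sym (*-identityˡ _)) (ι-* m n) ⟩
    1# * ι n + ι m * ι n  ≈⟨ distribʳ _ _ _ ⟨
    (1# + ι m) * ι n      ∎

  -- numerals with `num 1` literally 1#, so that solver output matches goals
  num : ℕ → Carrier
  num zero          = 0#
  num (suc zero)    = 1#
  num (suc (suc n)) = 1# + num (suc n)

  num≈ι : ∀ n → num n ≈ ι n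
  num≈ι zero          = refl
  num≈ι (suc zero)    = sym (+-identityʳ 1#)
  num≈ι (suc (suc n)) = +-congˡ (num≈ι (suc n))

  ⟦_⟧ : ℤ → Carrier
  ⟦ + n ⟧      = ι n
  ⟦ -[1+ n ] ⟧ = - ι (suc n)

  ⊖-hom : ∀ m n → ⟦ m ⊖ n ⟧ ≈ ι m + - ι n
  ⊖-hom zero    zero    = sym (trans (+-identityˡ _) -0#≈0#)
  ⊖-hom zero    (suc n) = sym (+-identityˡ _)
  ⊖-hom (suc m) zero    = sym (trans (+-congˡ -0#≈0#) (+-identityʳ _))
  ⊖-hom (suc m) (suc n) = begin
    ⟦ suc m ⊖ suc n ⟧          ≈⟨ reflexive (P.cong ⟦_⟧ (ℤP.[1+m]⊖[1+n]≡m⊖n m n)) ⟩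
    ⟦ m ⊖ n ⟧                  ≈⟨ ⊖-hom m n ⟩
    ι m + - ι n                ≈⟨ cancel-one (ι m) (ι n) ⟨
    (1# + ι m) + - (1# + ι n)  ∎
    where
    cancel-one : ∀ x y → (1# + x) + - (1# + y) ≈ x + - y
    cancel-one x y = begin
      (1# + x) + - (1# + y)    ≈⟨ +-congˡ (-‿+-comm 1# y) ⟨
      (1# + x) + (- 1# + - y)  ≈⟨ +-congʳ (+-comm 1# x) ⟩
      (x + 1#) + (- 1# + - y)  ≈⟨ +-assoc x 1# _ ⟩
      x + (1# + (- 1# + - y))  ≈⟨ +-congˡ (+-assoc 1# (- 1#) (- y)) ⟨
      x + ((1# + - 1#) + - y)  ≈⟨ +-congˡ (+-congʳ (-‿inverseʳ 1#)) ⟩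
      x + (0# + - y)           ≈⟨ +-congˡ (+-identityˡ _) ⟩
      x + - y                  ∎

  neg-hom : ∀ x → ⟦ ℤ.- x ⟧ ≈ - ⟦ x ⟧
  neg-hom (+ zero)    = sym -0#≈0#
  neg-hom (+ suc n)   = refl
  neg-hom -[1+ n ]    = sym (-‿involutive _)

  add-hom : ∀ x y → ⟦ x ℤ.+ y ⟧ ≈ ⟦ x ⟧ + ⟦ y ⟧
  add-hom (+ m)    (+ n)    = ι-+ m n
  add-hom (+ m)    -[1+ n ] = ⊖-hom m (suc n)
  add-hom -[1+ m ] (+ n)    = trans (⊖-hom n (suc m)) (+-comm _ _)
  add-hom -[1+ m ] -[1+ n ] = begin
    - (1# + ι (suc m ℕ.+ n))     ≈⟨ -‿cong (+-congˡ (ι-+ (suc m) n)) ⟩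
    - (1# + (ι (suc m) + ι n))   ≈⟨ -‿cong (+-assoc 1# _ _) ⟨
    - ((1# + ι (suc m)) + ι n)   ≈⟨ -‿cong (+-congʳ (+-comm 1# _)) ⟩
    - ((ι (suc m) + 1#) + ι n)   ≈⟨ -‿cong (+-assoc _ 1# _) ⟩
    - (ι (suc m) + ι (suc n))    ≈⟨ -‿+-comm _ _ ⟨
    - ι (suc m) + - ι (suc n)    ∎

  +◃-hom : ∀ n → ⟦ Sign.+ ◃ n ⟧ ≈ ι n
  +◃-hom n = reflexive (P.cong ⟦_⟧ (ℤP.+◃n≡+n n))

  -◃-hom : ∀ n → ⟦ Sign.- ◃ n ⟧ ≈ - ι n
  -◃-hom n = trans (reflexive (P.cong ⟦_⟧ (ℤP.-◃n≡-n n))) (neg-hom (+ n))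

  neg*neg : ∀ x y → - x * - y ≈ x * y
  neg*neg x y = trans (sym (-‿distribˡ-* x (- y)))
                  (trans (-‿cong (sym (-‿distribʳ-* x y))) (-‿involutive _))

  mul-hom : ∀ x y → ⟦ x ℤ.* y ⟧ ≈ ⟦ x ⟧ * ⟦ y ⟧
  mul-hom (+ m)    (+ n)    = trans (+◃-hom (m ℕ.* n)) (ι-* m n)
  mul-hom (+ m)    -[1+ n ] =
    trans (-◃-hom (m ℕ.* suc n)) (trans (-‿cong (ι-* m (suc n))) (-‿distribʳ-* _ _))
  mul-hom -[1+ m ] (+ n)    =
    trans (-◃-hom (suc m ℕ.* n)) (trans (-‿cong (ι-* (suc m) n)) (-‿distribˡ-* _ _))
  mul-hom -[1+ m ] -[1+ n ] =
    trans (+◃-hom (suc m ℕ.* suc n)) (trans (ι-* (suc m) (suc n)) (sym (neg*neg _ _)))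

  ⟦_⟧num : ℤ → Carrier
  ⟦ + n ⟧num      = num n
  ⟦ -[1+ n ] ⟧num = - num (suc n)

  num-agrees : ∀ x → ⟦ x ⟧num ≈ ⟦ x ⟧
  num-agrees (+ n)    = num≈ι n
  num-agrees -[1+ n ] = -‿cong (num≈ι (suc n))

  homomorphism : ℤ.+-*-rawRing ACR.-Raw-AlmostCommutative⟶ ACR.fromCommutativeRing R
  homomorphism = record
    { ⟦_⟧    = ⟦_⟧num
    ; +-homo = λ x y → transport (x ℤ.+ y) (add-hom x y) (+-cong (num-agrees x) (num-agrees y))
    ; *-homo = λ x y → transport (x ℤ.* y) (mul-hom x y) (*-cong (num-agrees x) (num-agrees y))
    ; -‿homo = λ x → transport (ℤ.- x) (neg-hom x) (-‿cong (num-agrees x))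
    ; 0-homo = refl
    ; 1-homo = refl
    }
    where
    transport : ∀ z {u u'} → ⟦ z ⟧ ≈ u → u' ≈ u → ⟦ z ⟧num ≈ u'
    transport z e e' = trans (num-agrees z) (trans e (sym e'))

  decide : ∀ x y → Maybe (⟦ x ⟧num ≈ ⟦ y ⟧num)
  decide x y with x ℤ.≟ y
  ... | yes P.refl = just refl
  ... | no _       = nothing

  open RingSolver ℤ.+-*-rawRing (ACR.fromCommutativeRing R) homomorphism decide public
    using (solve; _:=_; con; _:+_; _:*_; :-_; _:-_)

module CentralBinomials {c ℓ : Level} (K : QAlgebra c ℓ) where
  open QAlgebra K
  open IntegerSolver cring using (ι-+; ι-*; num; num≈ι; solve; _:=_; con; _:+_; _:*_; :-_; _:-_)
  open SetoidReasoning setoid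

  -- Finite sums Σ_{i<m}.

  sum-cong< : ∀ m {f g : ℕ → Carrier} → (∀ i → i ℕ.< m → f i ≈ g i) → sumBelow m f ≈ sumBelow m g
  sum-cong< zero    _  = refl
  sum-cong< (suc m) eq = +-cong (sum-cong< m (λ i i<m → eq i (ℕP.m<n⇒m<1+n i<m))) (eq m ℕP.≤-refl)

  sum-+ : ∀ m (f g : ℕ → Carrier) → sumBelow m (λ i → f i + g i) ≈ sumBelow m f + sumBelow m g
  sum-+ zero    f g = sym (+-identityʳ 0#)
  sum-+ (suc m) f g = trans (+-congʳ (sum-+ m f g))
    (solve 4 (λ A B X Y → (A :+ B) :+ (X :+ Y) := (A :+ X) :+ (B :+ Y)) refl _ _ _ _)

  sum-*ˡ : ∀ m x (f : ℕ → Carrier) → sumBelow m (λ i → x * f i) ≈ x * sumBelow m f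
  sum-*ˡ zero    x f = sym (zeroʳ x)
  sum-*ˡ (suc m) x f = trans (+-congʳ (sum-*ˡ m x f)) (sym (distribˡ x _ _))

  sum-peel : ∀ m (f : ℕ → Carrier) → sumBelow (suc m) f ≈ f 0 + sumBelow m (λ i → f (suc i))
  sum-peel zero    f = +-comm 0# (f 0)
  sum-peel (suc m) f = trans (+-congʳ (sum-peel m f)) (+-assoc _ _ _)

  sum-reverse : ∀ m (f : ℕ → Carrier) → sumBelow m f ≈ sumBelow m (λ i → f (m ∸ suc i))
  sum-reverse zero    f = refl
  sum-reverse (suc m) f = begin
    sumBelow m f + f m                      ≈⟨ +-congʳ (sum-reverse m f) ⟩
    sumBelow m (λ i → f (m ∸ suc i)) + f m  ≈⟨ +-comm _ _ ⟩
    f m + sumBelow m (λ i → f (m ∸ suc i))  ≈⟨ sum-peel m (λ i → f (m ∸ i)) ⟨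
    sumBelow (suc m) (λ i → f (m ∸ i))      ∎

  ι-split : ∀ {i n} → i ℕ.≤ n → ι n ≈ ι i + ι (n ∸ i)
  ι-split {i} {n} i≤n = trans (reflexive (P.cong ι (P.sym (ℕP.m+[n∸m]≡n i≤n)))) (ι-+ i (n ∸ i))

  -- Sequences as coefficient lists of formal power series in t.  The
  -- convolution f ⋆ g is their product; delay, euler and deriv are
  -- multiplication by t, the operator t·d/dt and the derivative d/dt.

  Seq : Set c
  Seq = ℕ → Carrier

  infixl 7 _⋆_
  _⋆_ : Seq → Seq → Seq
  (f ⋆ g) n = sumAntidiag n (λ i j → f i * g j)

  delay : Seq → Seq
  delay f zero    = 0#
  delay f (suc i) = f i

  euler : Seq → Seq
  euler f i = ι i * f i

  deriv : Seq → Seq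
  deriv f i = ι (suc i) * f (suc i)

  ⋆-cong : ∀ {f f' g g' : Seq} → (∀ i → f i ≈ f' i) → (∀ j → g j ≈ g' j) →
           ∀ n → (f ⋆ g) n ≈ (f' ⋆ g') n
  ⋆-cong ef eg n = sum-cong< (suc n) (λ i _ → *-cong (ef i) (eg (n ∸ i)))

  ⋆-comm : ∀ f g n → (f ⋆ g) n ≈ (g ⋆ f) n
  ⋆-comm f g n = trans (sum-reverse (suc n) _) (sum-cong< (suc n) swap)
    where
    swap : ∀ i → i ℕ.< suc n → f (n ∸ i) * g (n ∸ (n ∸ i)) ≈ g i * f (n ∸ i)
    swap i i<1+n =
      trans (*-comm _ _) (*-congʳ (reflexive (P.cong g (ℕP.m∸[m∸n]≡n (ℕP.≤-pred i<1+n)))))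

  ⋆-+ˡ : ∀ f g h n → ((λ i → f i + g i) ⋆ h) n ≈ (f ⋆ h) n + (g ⋆ h) n
  ⋆-+ˡ f g h n = trans (sum-cong< (suc n) (λ i _ → distribʳ _ _ _)) (sum-+ (suc n) _ _)

  ⋆-*ˡ : ∀ x f h n → ((λ i → x * f i) ⋆ h) n ≈ x * (f ⋆ h) n
  ⋆-*ˡ x f h n = trans (sum-cong< (suc n) (λ i _ → *-assoc _ _ _)) (sum-*ˡ (suc n) x _)

  ⋆-linearˡ : ∀ x y f g h n →
              ((λ i → x * f i + y * g i) ⋆ h) n ≈ x * (f ⋆ h) n + y * (g ⋆ h) n
  ⋆-linearˡ x y f g h n = trans (⋆-+ˡ _ _ h n) (+-cong (⋆-*ˡ x f h n) (⋆-*ˡ y g h n))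

  ⋆-peel : ∀ f g n → (f ⋆ g) (suc n) ≈ f 0 * g (suc n) + ((λ i → f (suc i)) ⋆ g) n
  ⋆-peel f g n = sum-peel (suc n) _

  delay-⋆ : ∀ f g n → (delay f ⋆ g) (suc n) ≈ (f ⋆ g) n
  delay-⋆ f g n = trans (⋆-peel (delay f) g n) (trans (+-congʳ (zeroˡ _)) (+-identityˡ _))

  euler-⋆ : ∀ f g n → ι n * (f ⋆ g) n ≈ (euler f ⋆ g) n + (f ⋆ euler g) n
  euler-⋆ f g n = trans (sym (sum-*ˡ (suc n) (ι n) _))
                    (trans (sum-cong< (suc n) split) (sum-+ (suc n) _ _))
    where
    split : ∀ i → i ℕ.< suc n →
            ι n * (f i * g (n ∸ i)) ≈ (ι i * f i) * g (n ∸ i) + f i * (ι (n ∸ i) * g (n ∸ i))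
    split i i<1+n = trans (*-congʳ (ι-split (ℕP.≤-pred i<1+n)))
      (solve 4 (λ U V F G → (U :+ V) :* (F :* G) := (U :* F) :* G :+ F :* (V :* G)) refl _ _ _ _)

  euler-⋆-suc : ∀ f g n → (euler f ⋆ g) (suc n) ≈ (deriv f ⋆ g) n
  euler-⋆-suc f g n = trans (⋆-peel (euler f) g n)
    (trans (+-congʳ (trans (*-congʳ (zeroˡ _)) (zeroˡ _))) (+-identityˡ _))

  leibniz : ∀ f g n → ι (suc n) * (f ⋆ g) (suc n) ≈ (deriv f ⋆ g) n + (deriv g ⋆ f) n
  leibniz f g n = begin
    ι (suc n) * (f ⋆ g) (suc n)                    ≈⟨ euler-⋆ f g (suc n) ⟩
    (euler f ⋆ g) (suc n) + (f ⋆ euler g) (suc n)  ≈⟨ +-congˡ (⋆-comm f (euler g) (suc n)) ⟩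
    (euler f ⋆ g) (suc n) + (euler g ⋆ f) (suc n)  ≈⟨ +-cong (euler-⋆-suc f g n) (euler-⋆-suc g f n) ⟩
    (deriv f ⋆ g) n + (deriv g ⋆ f) n              ∎

  -- Generalized binomial coefficients.

  falling-cong : ∀ {x y} i → x ≈ y → falling x i ≈ falling y i
  falling-cong zero    e = refl
  falling-cong (suc i) e = *-cong (falling-cong i e) (+-congʳ e)

  binom-cong : ∀ {x y} i → x ≈ y → binom x i ≈ binom y i
  binom-cong i e = *-congʳ (falling-cong i e)

  falling-suc : ∀ y k → falling (y + 1#) (suc k) ≈ (y + 1#) * falling y k
  falling-suc y zero    = solve 1 (λ Y → con (+ 1) :* ((Y :+ con (+ 1)) :- con (+ 0))
                                       := (Y :+ con (+ 1)) :* con (+ 1)) refl y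
  falling-suc y (suc k) = begin
    falling (y + 1#) (suc k) * ((y + 1#) + - ι (suc k))  ≈⟨ *-congʳ (falling-suc y k) ⟩
    ((y + 1#) * falling y k) * ((y + 1#) + - ι (suc k))
      ≈⟨ solve 3 (λ Y F T → ((Y :+ con (+ 1)) :* F) :* ((Y :+ con (+ 1)) :- (con (+ 1) :+ T))
                          := (Y :+ con (+ 1)) :* (F :* (Y :- T))) refl y (falling y k) (ι k) ⟩
    (y + 1#) * falling y (suc k)                          ∎

  invFact-suc : ∀ k u → ι (suc k) * (u * invFact (suc k)) ≈ u * invFact k
  invFact-suc k u = begin
    ι (suc k) * (u * (invFact k * inv k))
      ≈⟨ solve 4 (λ T U I V → T :* (U :* (I :* V)) := (U :* I) :* (T :* V)) refl _ _ _ _ ⟩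
    (u * invFact k) * (ι (suc k) * inv k)  ≈⟨ *-congˡ (inv-spec k) ⟩
    (u * invFact k) * 1#                   ≈⟨ *-identityʳ _ ⟩
    u * invFact k                          ∎

  binom-ratio : ∀ y k → ι (suc k) * binom y (suc k) ≈ (y + - ι k) * binom y k
  binom-ratio y k = trans (invFact-suc k _)
    (solve 3 (λ F D I → (F :* D) :* I := D :* (F :* I)) refl _ _ _)

  binom-absorb : ∀ y k → ι (suc k) * binom (y + 1#) (suc k) ≈ (y + 1#) * binom y k
  binom-absorb y k = trans (invFact-suc k _) (trans (*-congʳ (falling-suc y k)) (*-assoc _ _ _))

  ι-cancel : ∀ k {x y} → ι (suc k) * x ≈ ι (suc k) * y → x ≈ y
  ι-cancel k {x} {y} e = trans (sym (undo x)) (trans (*-congˡ e) (undo y))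
    where
    undo : ∀ z → inv k * (ι (suc k) * z) ≈ z
    undo z = trans (sym (*-assoc _ _ _))
               (trans (*-congʳ (trans (*-comm _ _) (inv-spec k))) (*-identityˡ z))

  -- Pascal's rule: absorption and the ratio, after multiplying by k+1
  pascal : ∀ y k → binom (y + 1#) (suc k) ≈ binom y (suc k) + binom y k
  pascal y k = ι-cancel k (begin
    ι (suc k) * binom (y + 1#) (suc k)                   ≈⟨ binom-absorb y k ⟩
    (y + 1#) * binom y k
      ≈⟨ solve 3 (λ Y T B → (Y :+ con (+ 1)) :* B := (Y :- T) :* B :+ (con (+ 1) :+ T) :* B)
                 refl y (ι k) (binom y k) ⟩
    (y + - ι k) * binom y k + ι (suc k) * binom y k      ≈⟨ +-congʳ (binom-ratio y k) ⟨
    ι (suc k) * binom y (suc k) + ι (suc k) * binom y k  ≈⟨ distribˡ _ _ _ ⟨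
    ι (suc k) * (binom y (suc k) + binom y k)            ∎)

  central : Carrier → Seq
  central x i = binom (two* i + x) i

  -- the ring element 2m in the form the solver manipulates
  two*≈ : ∀ m → two* m ≈ num 2 * ι m
  two*≈ m = trans (ι-* 2 m) (*-congʳ (sym (num≈ι 2)))

  -- The algebra behind the recurrence: for w = 2(k+1) + x, p = binom w (k+1)
  -- and q = binom w k, the ratio relation (k+1) p = (w - k) q rewrites
  -- (w+2)(p+q) as a combination whose coefficients involve x but not w.
  central-identity : ∀ x k p q → let w = num 2 * ι (suc k) + x in
    ι (suc k) * p ≈ (w + - ι k) * q →
    ((w + 1#) + 1#) * (p + q)
      ≈ (x * (p + q) + - (num 2 * x) * q) + (num 4 * (ι (suc k) * p) + num 2 * p)
  central-identity x k p q ratio = begin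
    ((w + 1#) + 1#) * (p + q)
      ≈⟨ solve 4 (λ P Q X T → let W = con (+ 2) :* (con (+ 1) :+ T) :+ X in
             ((W :+ con (+ 1)) :+ con (+ 1)) :* (P :+ Q)
          := ((X :* (P :+ Q) :+ (:- (con (+ 2) :* X)) :* Q)
              :+ (con (+ 4) :* ((con (+ 1) :+ T) :* P) :+ con (+ 2) :* P))
             :+ con (+ 2) :* ((W :- T) :* Q :+ :- ((con (+ 1) :+ T) :* P)))
             refl p q x (ι k) ⟩
    rhs + num 2 * ((w + - ι k) * q + - (ι (suc k) * p))   ≈⟨ +-congˡ (*-congˡ (+-congˡ (-‿cong ratio))) ⟩
    rhs + num 2 * ((w + - ι k) * q + - ((w + - ι k) * q)) ≈⟨ +-congˡ (*-congˡ (-‿inverseʳ _)) ⟩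
    rhs + num 2 * 0#                                      ≈⟨ +-congˡ (zeroʳ _) ⟩
    rhs + 0#                                              ≈⟨ +-identityʳ _ ⟩
    rhs                                                   ∎
    where
    w = num 2 * ι (suc k) + x
    rhs = (x * (p + q) + - (num 2 * x) * q) + (num 4 * (ι (suc k) * p) + num 2 * p)

  central-recurrence : ∀ x i →
    deriv (central x) i
      ≈ (x * central (x + 1#) i + - (num 2 * x) * delay (central (x + num 2)) i)
        + (num 4 * euler (central x) i + num 2 * central x i)
  central-recurrence x zero =
    trans (*-congˡ (binom-cong 1 (solve 1 (λ X → (con (+ 1) :+ (con (+ 1) :+ con (+ 0))) :+ X
                                              := (X :+ con (+ 1)) :+ con (+ 1)) refl x)))
      (trans (binom-absorb (x + 1#) 0)
        (solve 1 (λ X → ((X :+ con (+ 1)) :+ con (+ 1)) :* (con (+ 1) :* con (+ 1))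
                     := (X :* (con (+ 1) :* con (+ 1)) :+ (:- (con (+ 2) :* X)) :* con (+ 0))
                        :+ (con (+ 4) :* (con (+ 0) :* (con (+ 1) :* con (+ 1)))
                            :+ con (+ 2) :* (con (+ 1) :* con (+ 1)))) refl x))
  central-recurrence x (suc k) = begin
    ι (suc (suc k)) * binom (two* (suc (suc k)) + x) (suc (suc k))
      ≈⟨ *-congˡ (binom-cong (suc (suc k)) top) ⟩
    ι (suc (suc k)) * binom ((w + 1#) + 1#) (suc (suc k))  ≈⟨ binom-absorb (w + 1#) (suc k) ⟩
    ((w + 1#) + 1#) * binom (w + 1#) (suc k)               ≈⟨ *-congˡ (pascal w k) ⟩
    ((w + 1#) + 1#) * (p + q)                              ≈⟨ central-identity x k p q (binom-ratio w k) ⟩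
    (x * (p + q) + - (num 2 * x) * q) + (num 4 * (ι (suc k) * p) + num 2 * p)
      ≈⟨ +-cong (+-cong (*-congˡ shift-1) (*-congˡ shift-2))
                (+-cong (*-congˡ (*-congˡ shift-0)) (*-congˡ shift-0)) ⟨
    (x * central (x + 1#) (suc k) + - (num 2 * x) * central (x + num 2) k)
      + (num 4 * (ι (suc k) * central x (suc k)) + num 2 * central x (suc k))  ∎
    where
    w = num 2 * ι (suc k) + x
    p = binom w (suc k)
    q = binom w k
    top : two* (suc (suc k)) + x ≈ (w + 1#) + 1#
    top = trans (+-congʳ (two*≈ (suc (suc k))))
      (solve 2 (λ T X → con (+ 2) :* (con (+ 1) :+ (con (+ 1) :+ T)) :+ X
                     := ((con (+ 2) :* (con (+ 1) :+ T) :+ X) :+ con (+ 1)) :+ con (+ 1)) refl (ι k) x)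
    shift-0 : central x (suc k) ≈ p
    shift-0 = binom-cong (suc k) (+-congʳ (two*≈ (suc k)))
    shift-1 : central (x + 1#) (suc k) ≈ p + q
    shift-1 = trans (binom-cong (suc k) (trans (+-congʳ (two*≈ (suc k))) (sym (+-assoc _ _ _))))
                (pascal w k)
    shift-2 : central (x + num 2) k ≈ q
    shift-2 = binom-cong k (trans (+-congʳ (two*≈ k))
      (solve 2 (λ T X → con (+ 2) :* T :+ (X :+ con (+ 2)) := con (+ 2) :* (con (+ 1) :+ T) :+ X)
             refl (ι k) x))

  deriv-central-⋆ : ∀ x h n →
    (deriv (central x) ⋆ h) n
      ≈ (x * (central (x + 1#) ⋆ h) n + - (num 2 * x) * (delay (central (x + num 2)) ⋆ h) n)
        + (num 4 * (euler (central x) ⋆ h) n + num 2 * (central x ⋆ h) n)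
  deriv-central-⋆ x h n =
    trans (⋆-cong {g = h} (central-recurrence x) (λ _ → refl) n)
      (trans (⋆-+ˡ _ _ h n) (+-cong (⋆-linearˡ _ _ _ _ h n) (⋆-linearˡ _ _ _ _ h n)))

  centralConv : ℕ → Carrier → Carrier → Carrier
  centralConv n a b = (central a ⋆ central b) n

  shiftedConv : ℕ → Carrier → Carrier → Carrier
  shiftedConv n a b = (delay (central a) ⋆ central b) n

  shiftedConv-suc : ∀ n a b → shiftedConv (suc n) a b ≈ centralConv n a b
  shiftedConv-suc n a b = delay-⋆ (central a) (central b) n

  -- Leibniz rule plus the recurrence for both factors; the Euler terms of the
  -- two factors add up to n times the convolution.
  centralConv-recurrence : ∀ n a b →
    ι (suc n) * centralConv (suc n) a b
      ≈ (a * centralConv n (a + 1#) b + b * centralConv n (b + 1#) a)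
        + (- (num 2 * a) * shiftedConv n (a + num 2) b + - (num 2 * b) * shiftedConv n (b + num 2) a)
        + (num 4 * ι n + num 4) * centralConv n a b
  centralConv-recurrence n a b = begin
    ι (suc n) * centralConv (suc n) a b
      ≈⟨ leibniz (central a) (central b) n ⟩
    (deriv (central a) ⋆ central b) n + (deriv (central b) ⋆ central a) n
      ≈⟨ +-cong (deriv-central-⋆ a (central b) n) (deriv-central-⋆ b (central a) n) ⟩
    ((a * A₁ + - (num 2 * a) * A₂) + (num 4 * E₁ + num 2 * S))
      + ((b * B₁ + - (num 2 * b) * B₂) + (num 4 * E₂ + num 2 * S'))
      ≈⟨ +-congˡ (+-congˡ (+-congˡ (*-congˡ (⋆-comm (central b) (central a) n)))) ⟩
    ((a * A₁ + - (num 2 * a) * A₂) + (num 4 * E₁ + num 2 * S))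
      + ((b * B₁ + - (num 2 * b) * B₂) + (num 4 * E₂ + num 2 * S))
      ≈⟨ solve 9 (λ a b A₁ A₂ B₁ B₂ E₁ E₂ S →
             ((a :* A₁ :+ (:- (con (+ 2) :* a)) :* A₂) :+ (con (+ 4) :* E₁ :+ con (+ 2) :* S))
               :+ ((b :* B₁ :+ (:- (con (+ 2) :* b)) :* B₂) :+ (con (+ 4) :* E₂ :+ con (+ 2) :* S))
          := (a :* A₁ :+ b :* B₁) :+ ((:- (con (+ 2) :* a)) :* A₂ :+ (:- (con (+ 2) :* b)) :* B₂)
               :+ (con (+ 4) :* (E₁ :+ E₂) :+ con (+ 4) :* S))
          refl a b A₁ A₂ B₁ B₂ E₁ E₂ S ⟩
    (a * A₁ + b * B₁) + (- (num 2 * a) * A₂ + - (num 2 * b) * B₂) + (num 4 * (E₁ + E₂) + num 4 * S)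
      ≈⟨ +-congˡ (+-congʳ (*-congˡ euler-terms)) ⟩
    (a * A₁ + b * B₁) + (- (num 2 * a) * A₂ + - (num 2 * b) * B₂) + (num 4 * (ι n * S) + num 4 * S)
      ≈⟨ +-congˡ (trans (+-congʳ (sym (*-assoc _ _ _))) (sym (distribʳ _ _ _))) ⟩
    (a * A₁ + b * B₁) + (- (num 2 * a) * A₂ + - (num 2 * b) * B₂) + (num 4 * ι n + num 4) * S  ∎
    where
    A₁ = centralConv n (a + 1#) b
    B₁ = centralConv n (b + 1#) a
    A₂ = shiftedConv n (a + num 2) b
    B₂ = shiftedConv n (b + num 2) a
    E₁ = (euler (central a) ⋆ central b) n
    E₂ = (euler (central b) ⋆ central a) n
    S  = centralConv n a b
    S' = centralConv n b a
    euler-terms : E₁ + E₂ ≈ ι n * S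
    euler-terms = trans (+-congˡ (⋆-comm (euler (central b)) (central a) n))
                        (sym (euler-⋆ (central a) (central b) n))

  SumInvariant : (Carrier → Carrier → Carrier) → Set (c ⊔ ℓ)
  SumInvariant F = ∀ {a b a' b'} → a + b ≈ a' + b' → F a b ≈ F a' b'

  -- the right-hand side of the recurrence with every convolution normalised
  -- to shifts of the form (s + u, 0)
  reduced : ℕ → Carrier → Carrier
  reduced n s = s * centralConv n (s + 1#) 0# + - (num 2 * s) * shiftedConv n (s + num 2) 0#
                + (num 4 * ι n + num 4) * centralConv n s 0#

  recurrence-reduces : ∀ n → SumInvariant (centralConv n) → SumInvariant (shiftedConv n) →
                       ∀ a b → ι (suc n) * centralConv (suc n) a b ≈ reduced n (a + b)
  recurrence-reduces n inv inv⁻ a b = begin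
    ι (suc n) * centralConv (suc n) a b  ≈⟨ centralConv-recurrence n a b ⟩
    (a * centralConv n (a + 1#) b + b * centralConv n (b + 1#) a)
      + (- (num 2 * a) * shiftedConv n (a + num 2) b + - (num 2 * b) * shiftedConv n (b + num 2) a)
      + κ * centralConv n a b
      ≈⟨ +-cong (+-cong (+-cong (*-congˡ (inv (left 1#))) (*-congˡ (inv (right 1#))))
                        (+-cong (*-congˡ (inv⁻ (left (num 2)))) (*-congˡ (inv⁻ (right (num 2))))))
                (*-congˡ (inv (sym (+-identityʳ _)))) ⟩
    (a * Z₁ + b * Z₁) + (- (num 2 * a) * Z₂ + - (num 2 * b) * Z₂) + κ * Z₀
      ≈⟨ solve 6 (λ a b Z₁ Z₂ k Z₀ →
             (a :* Z₁ :+ b :* Z₁) :+ ((:- (con (+ 2) :* a)) :* Z₂ :+ (:- (con (+ 2) :* b)) :* Z₂) :+ k :* Z₀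
          := (a :+ b) :* Z₁ :+ (:- (con (+ 2) :* (a :+ b))) :* Z₂ :+ k :* Z₀)
          refl a b Z₁ Z₂ κ Z₀ ⟩
    reduced n (a + b)  ∎
    where
    κ  = num 4 * ι n + num 4
    Z₀ = centralConv n (a + b) 0#
    Z₁ = centralConv n ((a + b) + 1#) 0#
    Z₂ = shiftedConv n ((a + b) + num 2) 0#
    left : ∀ u → (a + u) + b ≈ ((a + b) + u) + 0#
    left u = solve 3 (λ U A B → (A :+ U) :+ B := ((A :+ B) :+ U) :+ con (+ 0)) refl u a b
    right : ∀ u → (b + u) + a ≈ ((a + b) + u) + 0#
    right u = solve 3 (λ U A B → (B :+ U) :+ A := ((A :+ B) :+ U) :+ con (+ 0)) refl u a b

  -- induction step: divide the reduced recurrence by n+1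
  invariance-step : ∀ n → SumInvariant (centralConv n) → SumInvariant (shiftedConv n) →
                    SumInvariant (centralConv (suc n))
  invariance-step n inv inv⁻ {a} {b} {a'} {b'} e = ι-cancel n (begin
    ι (suc n) * centralConv (suc n) a b    ≈⟨ recurrence-reduces n inv inv⁻ a b ⟩
    reduced n (a + b)                      ≈⟨ reduced-cong ⟩
    reduced n (a' + b')                    ≈⟨ recurrence-reduces n inv inv⁻ a' b' ⟨
    ι (suc n) * centralConv (suc n) a' b'  ∎)
    where
    reduced-cong : reduced n (a + b) ≈ reduced n (a' + b')
    reduced-cong = +-cong (+-cong (*-cong e (inv (+-congʳ (+-congʳ e))))
                                  (*-cong (-‿cong (*-congˡ e)) (inv⁻ (+-congʳ (+-congʳ e)))))
                          (*-congˡ (inv (+-congʳ e)))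

  -- In degree 0 both convolutions are constants (1 and 0).
  invariance : ∀ n → SumInvariant (centralConv n) × SumInvariant (shiftedConv n)
  invariance zero    = (λ _ → refl) , (λ _ → refl)
  invariance (suc n) =
    let inv , inv⁻ = invariance n in
    invariance-step n inv inv⁻ ,
    λ e → trans (shiftedConv-suc n _ _) (trans (inv e) (sym (shiftedConv-suc n _ _)))

-- With b = 0 on the left and shifts (a - l, l) on the right, the two sums are
-- central convolutions with the same total shift a.
lemma3p3 : ∀ {c ℓ} (K : QAlgebra c ℓ) → let open QAlgebra K in
    ∀ (n : ℕ) (a l : Carrier) →
      sumAntidiag n (λ i j → binom (two* i + a) i * binom (two* j) j)
        ≈ sumAntidiag n (λ i j → binom (two* i + a + - l) i * binom (two* j + l) j)
lemma3p3 K n a l = begin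
    sumAntidiag n (λ i j → binom (two* i + a) i * binom (two* j) j)
      ≈⟨ ⋆-cong {g = λ j → binom (two* j) j} (λ _ → refl)
                (λ j → binom-cong j (sym (+-identityʳ _))) n ⟩
    centralConv n a 0#
      ≈⟨ proj₁ (invariance n) (solve 2 (λ A L → A :+ con (+ 0) := (A :- L) :+ L) refl a l) ⟩
    centralConv n (a + - l) l
      ≈⟨ ⋆-cong {g = central l} (λ i → binom-cong i (sym (+-assoc _ _ _))) (λ _ → refl) n ⟩
    sumAntidiag n (λ i j → binom (two* i + a + - l) i * binom (two* j + l) j)  ∎
  where
  open QAlgebra K
  open IntegerSolver cring using (solve; _:=_; con; _:+_; _:-_)
  open CentralBinomials K
  open SetoidReasoning setoid
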